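{- Let $W$ be an abelian group, let $\omega\in W$, and let $(R_n)_{n\in\mathbb{Z}}$ be a sequence of reciprocity functions $R_n:V_0\to W$. Define a $W$-valued function $\widetilde{\mu}$ on primitive segments as follows: for $n\ge 0$, $\widetilde{\mu}(\infty,n)=\omega+\sum_{k=0}^{n-1}R_k(1,1)$; for $n\ge1$, $\widetilde{\mu}(\infty,-n)=\omega-\sum_{k=1}^{n}R_{ -k}(1,1)$; for all $n\in\mathbb{Z}$, $\widetilde{\mu}(n,\infty)=-\widetilde{\mu}(\infty,n)$; for $n\in\mathbb{Z}$ and rationals $0\le a/p<b/q\le 1$ written in lowest terms with $p,q\ge1$ such that $(n+a/p,\,n+b/q)$ is a primitive segment, $\widetilde{\mu}(n+a/p,\,n+b/q)=R_n(p,q)$; and for finite $\alpha<\beta$ with $(\alpha,\beta)$ primitive, $\widetilde{\mu}(\beta,\alpha)=-\widetilde{\mu}(\alpha,\beta)$. Then $\widetilde{\mu}$ satisfies $\widetilde{\mu}(\alpha,\beta)+\widetilde{\mu}(\beta,\alpha)=0$ for all primitive segments and $\widetilde{\mu}(\alpha,\beta)+\widetilde{\mu}(\beta,\gamma)+\widetilde{\mu}(\gamma,\alpha)=0$ whenever $(\alpha,\beta),(\beta,\gamma),(\gamma,\alpha)$ are primitive; hence it extends uniquely to a $W$-valued pseudo-measure $\mu$. Moreover, the data $\{R_n,\omega\}$ are recovered from $\mu$ by $\omega=\mu(\infty,0)$ and $R_n(p,q)=\mu(n+a/p,\,n+b/q)$, where $a/p<b/q$ are the ends of the unique primitive segment contained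 in $[0,1]$ whose ends have (positive) denominators $p$ and $q$.
   Context: $\mathbf{P}^1(\mathbb{Q})=\mathbb{Q}\cup\{\infty\}$. A $W$-valued pseudo-measure is a function $\mu:\mathbf{P}^1(\mathbb{Q})^2\to W$ with $\mu(\alpha,\alpha)=0$, $\mu(\alpha,\beta)+\mu(\beta,\alpha)=0$, $\mu(\alpha,\beta)+\mu(\beta,\gamma)+\mu(\gamma,\alpha)=0$ for all $\alpha,\beta,\gamma$. A primitive segment is an ordered pair $(\alpha,\beta)$ in $\mathbf{P}^1(\mathbb{Q})$ with $\alpha=a/c$, $\beta=b/d$ in lowest terms ($\infty=\pm 1/0$) and $ad-bc=\pm1$. Let $V_0=\{(p,q)\in\mathbb{Z}^2: p\ge1,\ q\ge1,\ \gcd(p,q)=1\}$. A ($W$-valued) reciprocity function is a map $R:V_0\to W$ satisfying $R(p+q,q)+R(p,p+q)=R(p,q)$ for all $(p,q)\in V_0$. The primitive segments contained in $[0,1]$, written $(a/p,b/q)$ with $a/p<b/q$ in lowest terms and $p,q\ge1$, are in bijection with $V_0$ via $(a/p,b/q)\mapsto(p,q)$. -}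

module Defs where

open import Level using (Level; _⊔_)
open import Algebra.Bundles using (AbelianGroup)
open import Data.Nat as ℕ using (ℕ; zero; suc)
open import Data.Nat.Coprimality using (Coprime)
open import Data.Integer as ℤ using (ℤ; +_; -[1+_])
open import Data.Rational as ℚ using (ℚ; ↥_; ↧_; ↧ₙ_; floor)
open import Data.Rational.Properties using (_<?_)
open import Data.Sum using (_⊎_)
open import Relation.Nullary using (yes; no)
open import Relation.Binary.PropositionalEquality using (_≡_)

data P1 : Set where
  ∞   : P1
  fin : ℚ → P1

num : P1 → ℤ
num ∞       = + 1
num (fin x) = ↥ x

den : P1 → ℤ
den ∞       = + 0
den (fin x) = ↧ x

Primitive : P1 → P1 → Set
Primitive α β =
  (num α ℤ.* den β ℤ.- num β ℤ.* den α ≡ + 1)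
    ⊎ (num α ℤ.* den β ℤ.- num β ℤ.* den α ≡ ℤ.- (+ 1))

intℚ : ℤ → ℚ
intℚ n = n ℚ./ 1

module _ {c ℓ : Level} (W : AbelianGroup c ℓ) where
  open AbelianGroup W

  InV0 : ℕ → ℕ → Set
  InV0 p q = (1 ℕ.≤ p) Data.Product.× (1 ℕ.≤ q) Data.Product.× Coprime p q
    where import Data.Product

  -- A reciprocity function (its values off V₀ are irrelevant).
  IsReciprocity : (ℕ → ℕ → Carrier) → Set ℓ
  IsReciprocity R = ∀ p q → InV0 p q →
    (R (p ℕ.+ q) q ∙ R p (p ℕ.+ q)) ≈ R p q

  IsPseudoMeasure : (P1 → P1 → Carrier) → Set ℓ
  IsPseudoMeasure μ =
    (∀ α → μ α α ≈ ε)
    Data.Product.× (∀ α β → (μ α β ∙ μ β α) ≈ ε)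
    Data.Product.× (∀ α β γ → ((μ α β ∙ μ β γ) ∙ μ γ α) ≈ ε)
    where import Data.Product

  module Construction (ω : Carrier) (R : ℤ → ℕ → ℕ → Carrier) where

    sumUp : ℕ → Carrier
    sumUp zero    = ε
    sumUp (suc n) = sumUp n ∙ R (+ n) 1 1

    sumDown : ℕ → Carrier
    sumDown zero    = ε
    sumDown (suc m) = sumDown m ∙ R (-[1+ m ]) 1 1

    μ∞ : ℤ → Carrier
    μ∞ (+ n)     = ω ∙ sumUp n
    μ∞ -[1+ m ]  = ω ∙ (sumDown (suc m)) ⁻¹

    -- μ̃ on pairs; only meaningful on primitive segments (junk ε elsewhere).
    -- For finite α < β primitive, α = n + a/p, β = n + b/q with n = ⌊α⌋,
    -- 0 ≤ a/p < b/q ≤ 1, and p, q are the denominators of α, β.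
    μ̃ : P1 → P1 → Carrier
    μ̃ ∞       ∞       = ε
    μ̃ ∞       (fin y) = μ∞ (↥ y)
    μ̃ (fin x) ∞       = (μ∞ (↥ x)) ⁻¹
    μ̃ (fin x) (fin y) with x <? y | y <? x
    ... | yes _ | _     = R (floor x) (↧ₙ x) (↧ₙ y)
    ... | no _  | yes _ = (R (floor y) (↧ₙ y) (↧ₙ x)) ⁻¹
    ... | no _  | no _  = ε

-- The primitive segments are the edges of the Farey graph on P¹(ℚ). Every
-- rational y of denominator ≥ 2 has a Farey neighbour of smaller denominator
-- (its parent) and the integers are joined to ∞, so the graph is connected
-- and a pseudo-measure is determined by its values on primitive segments.
-- For existence, integrate μ̃ along the parent tree: f ∞ = 0,
-- f n = μ̃ (∞ , n) and f y = f (parent y) + μ̃ (parent y , y), and put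
-- μ (α , β) = f β - f α. That μ = μ̃ on a primitive segment (x , y) with
-- ↧ x < ↧ y is shown by induction on denominators: either x is the parent
-- γ of y, or y is the mediant of γ < y < x, and on this Farey triangle the
-- cocycle relation for μ̃ is exactly the reciprocity law of R at (↧ γ , ↧ x).

module Submission where

open import Defs
open import Level using (Level)
open import Algebra.Bundles using (AbelianGroup)
open import Data.Nat as ℕ using (ℕ)
open import Data.Integer as ℤ using (ℤ)
open import Data.Rational as ℚ using (ℚ; ↧ₙ_; 0ℚ; 1ℚ)
open import Data.Product using (Σ; _×_; _,_)
open import Relation.Binary.PropositionalEquality using (_≡_)
import Relation.Binary.PropositionalEquality as ≡
open import Data.Sum using (inj₁; inj₂)

module Farey where

  open import Data.Nat using (zero; suc; z≤n; s≤s)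
  import Data.Nat.Properties as ℕP
  import Data.Nat.Divisibility as ℕD
  open import Data.Nat.Coprimality using (Coprime; coprime-Bézout; recompute)
  open import Data.Nat.GCD using (module Bézout)
  open import Data.Integer
    using (+_; -[1+_]; _+_; _*_; _-_; -_; _⊖_; _≤_; _<_; 0ℤ; 1ℤ; -1ℤ; ∣_∣; +<+; -<+)
  open import Data.Integer.Properties
  open import Data.Integer.DivMod
    using (_/ℕ_; _%ℕ_; [n/d]*d≤n; n<s[n/ℕd]*d; div-pos-is-/ℕ; n%ℕd<d; a≡a%ℕn+[a/ℕn]*n)
  open import Data.Integer.GCD using (gcd)
  open import Data.Integer.Divisibility.Signed
    using (_∣_; ∣ᵤ⇒∣; ∣⇒∣ᵤ; ∣-refl; ∣-reflexive; ∣m∣n⇒∣m-n; ∣n⇒∣m*n; ∣m⇒∣m*n; ∣m+n∣m⇒∣n)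
  open import Data.Integer.Tactic.RingSolver using (solve-∀)
  open import Data.Rational using (mkℚ; ↥_; ↧_; floor)
  import Data.Rational.Properties as ℚP
  open import Data.Product using (Σ-syntax; proj₁; proj₂)
  open import Data.Sum using (_⊎_)
  open import Function using (_∘_)
  open import Relation.Binary.Definitions using (tri<; tri≈; tri>)
  open import Relation.Binary.PropositionalEquality
  open import Relation.Nullary using (¬_; contradiction; yes; no)

  IsUnit : ℤ → Set
  IsUnit s = s ≡ + 1 ⊎ s ≡ - (+ 1)

  IsUnit-neg : ∀ {s} → IsUnit s → IsUnit (- s)
  IsUnit-neg (inj₁ refl) = inj₂ refl
  IsUnit-neg (inj₂ refl) = inj₁ refl

  IsUnit-∣⇒≡1 : ∀ {s d} → IsUnit s → + d ∣ s → d ≡ 1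
  IsUnit-∣⇒≡1 (inj₁ refl) d∣s = ℕD.∣1⇒≡1 (∣⇒∣ᵤ d∣s)
  IsUnit-∣⇒≡1 (inj₂ refl) d∣s = ℕD.∣1⇒≡1 (∣⇒∣ᵤ d∣s)

  IsUnit-+⇒≡1 : ∀ {n} → IsUnit (+ n) → n ≡ 1
  IsUnit-+⇒≡1 (inj₁ refl) = refl

  1+a≡b⇒b-a≡1 : ∀ {a b} → 1ℤ + a ≡ b → b - a ≡ 1ℤ
  1+a≡b⇒b-a≡1 {a} refl = cancel a
    where
    cancel : ∀ a → 1ℤ + a - a ≡ 1ℤ
    cancel = solve-∀

  0<j-i⇒i<j : ∀ {i j} → 0ℤ < j - i → i < j
  0<j-i⇒i<j {i} {j} 0<j-i = subst₂ _<_ (+-identityˡ i) (cancel i j) (+-monoˡ-< i 0<j-i)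
    where
    cancel : ∀ i j → j - i + i ≡ j
    cancel = solve-∀

  -1≤m*i⇒0≤i : ∀ m i → 1 ℕ.< m → -1ℤ ≤ + m * i → 0ℤ ≤ i
  -1≤m*i⇒0≤i m i 1<m -1≤m*i = i<j⇒suc[i]≤j (*-cancelˡ-<-nonNeg (+ m) (begin-strict
    + m * -1ℤ   ≡⟨ *-comm (+ m) -1ℤ ⟩
    -1ℤ * + m   ≡⟨ -1*i≡-i (+ m) ⟩
    - + m       <⟨ neg-mono-< (+<+ 1<m) ⟩
    -1ℤ         ≤⟨ -1≤m*i ⟩
    + m * i     ∎))
    where open ≤-Reasoning

  multiple-of-small-difference≡0 : ∀ D {e c h} → c ℕ.< e → h ℕ.< e
    → D * + e ≡ + c - + h → D ≡ 0ℤ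
  multiple-of-small-difference≡0 D {e} {c} {h} c<e h<e eq =
    ∣i∣≡0⇒i≡0 (ℕP.n<1⇒n≡0 (ℕP.*-cancelʳ-< e ∣ D ∣ 1 (begin-strict
      ∣ D ∣ ℕ.* e   ≡⟨ abs-* D (+ e) ⟨
      ∣ D * + e ∣   ≡⟨ cong ∣_∣ (trans eq (m-n≡m⊖n c h)) ⟩
      ∣ c ⊖ h ∣     ≤⟨ ∣m⊝n∣≤m⊔n c h ⟩
      c ℕ.⊔ h       <⟨ ℕP.⊔-lub c<e h<e ⟩
      e             ≡⟨ ℕP.*-identityˡ e ⟨
      1 ℕ.* e       ∎)))
    where open ℕP.≤-Reasoning

  multiple-of-small-sum≡1 : ∀ D e-1 {h c} → 1 ℕ.≤ h → h ℕ.< suc e-1 → c ℕ.< suc e-1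
    → D * + suc e-1 ≡ + (h ℕ.+ c) → D ≡ 1ℤ
  multiple-of-small-sum≡1 -[1+ _ ]     _   _         _   _   ()
  multiple-of-small-sum≡1 (+ zero)     _   (s≤s z≤n) _   _   ()
  multiple-of-small-sum≡1 (+ suc zero) _   _         _   _   _  = refl
  multiple-of-small-sum≡1 (+ suc (suc k)) e-1 _ h<e c<e eq =
    contradiction (+-injective eq) (ℕP.<⇒≢ (ℕP.<-≤-trans (ℕP.+-mono-< h<e c<e)
      (ℕP.+-monoʳ-≤ (suc e-1) (ℕP.m≤m+n (suc e-1) (k ℕ.* suc e-1)))) ∘ sym)

  pos-1+*≡* : ∀ p q r s → 1 ℕ.+ p ℕ.* q ≡ r ℕ.* s → 1ℤ + + p * + q ≡ + s * + r
  pos-1+*≡* p q r s eq = begin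
    1ℤ + + p * + q       ≡⟨ cong (λ t → 1ℤ + t) (pos-* p q) ⟨
    + (1 ℕ.+ p ℕ.* q)    ≡⟨ cong +_ (trans eq (ℕP.*-comm r s)) ⟩
    + (s ℕ.* r)          ≡⟨ pos-* s r ⟩
    + s * + r            ∎
    where open ≡-Reasoning

  ℕ-bézout : ∀ {m n} → Coprime m n → Σ[ u ∈ ℤ ] Σ[ v ∈ ℤ ] + m * u - v * + n ≡ 1ℤ
  ℕ-bézout {m} {n} coprime with coprime-Bézout coprime
  ... | Bézout.+- x y eq = + x , + y , 1+a≡b⇒b-a≡1 (pos-1+*≡* y n x m eq)
  ... | Bézout.-+ x y eq = - + x , - + y ,
    trans (swap (+ m) (+ x) (+ y) (+ n)) (1+a≡b⇒b-a≡1 (pos-1+*≡* x m y n eq))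
    where
    swap : ∀ m x y n → m * (- x) - (- y) * n ≡ n * y - x * m
    swap = solve-∀

  bézout : ∀ b e → Coprime ∣ b ∣ e → Σ[ u ∈ ℤ ] Σ[ v ∈ ℤ ] b * u - v * + e ≡ 1ℤ
  bézout (+ m)    e coprime = ℕ-bézout coprime
  bézout -[1+ m ] e coprime with ℕ-bézout coprime
  ... | u , v , eq = - u , v , trans (negate (+ suc m) u v (+ e)) eq
    where
    negate : ∀ m u v e → (- m) * (- u) - v * e ≡ m * u - v * e
    negate = solve-∀

  -- Primitive (fin x) (fin y) unfolds to IsUnit (det x y).
  det : ℚ → ℚ → ℤ
  det x y = ↥ x * ↧ y - ↥ y * ↧ x

  cross-antisym : ∀ a b c d → b * c - a * d ≡ - (a * d - b * c)
  cross-antisym = solve-∀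

  det-antisym : ∀ x y → det y x ≡ - det x y
  det-antisym x y = cross-antisym (↥ x) (↥ y) (↧ x) (↧ y)

  det-plücker : ∀ x y γ → det x γ * ↧ y ≡ det x y * ↧ γ - det γ y * ↧ x
  det-plücker x y γ = identity (↥ x) (↧ x) (↥ y) (↧ y) (↥ γ) (↧ γ)
    where
    identity : ∀ a c b e g h → (a * h - g * c) * e ≡ (a * e - b * c) * h - (g * e - b * h) * c
    identity = solve-∀

  Primitive-sym : ∀ α β → Primitive α β → Primitive β α
  Primitive-sym α β =
    subst IsUnit (sym (cross-antisym (num α) (num β) (den α) (den β))) ∘ IsUnit-neg

  det≡-1⇒< : ∀ x y → det x y ≡ -1ℤ → x ℚ.< y
  det≡-1⇒< x y eq = ℚ.*<* (begin-strict
    ↥ x * ↧ y               ≡⟨ split (↥ x * ↧ y) (↥ y * ↧ x) ⟩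
    ↥ y * ↧ x + det x y     ≡⟨ cong (λ d → ↥ y * ↧ x + d) eq ⟩
    ↥ y * ↧ x + -1ℤ         <⟨ +-monoʳ-< (↥ y * ↧ x) (-<+ {0} {0}) ⟩
    ↥ y * ↧ x + 0ℤ          ≡⟨ +-identityʳ _ ⟩
    ↥ y * ↧ x               ∎)
    where
    open ≤-Reasoning
    split : ∀ i j → i ≡ j + (i - j)
    split = solve-∀

  <⇒det≡-1 : ∀ {x y} → x ℚ.< y → Primitive (fin x) (fin y) → det x y ≡ -1ℤ
  <⇒det≡-1 x<y (inj₂ eq) = eq
  <⇒det≡-1 {x} {y} x<y (inj₁ eq) =
    contradiction x<y (ℚP.<-asym (det≡-1⇒< y x (trans (det-antisym x y) (cong -_ eq))))

  det≡0⇒≡ : ∀ {x y} → det x y ≡ 0ℤ → x ≡ y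
  det≡0⇒≡ eq = ℚP.≃⇒≡ (ℚ.*≡* (i-j≡0⇒i≡j _ _ eq))

  primitive⇒coprime-↧ₙ : ∀ x y → Primitive (fin x) (fin y) → Coprime (↧ₙ x) (↧ₙ y)
  primitive⇒coprime-↧ₙ x y p (i∣↧x , i∣↧y) =
    IsUnit-∣⇒≡1 p (∣m∣n⇒∣m-n (∣n⇒∣m*n (↥ x) (∣ᵤ⇒∣ i∣↧y)) (∣n⇒∣m*n (↥ y) (∣ᵤ⇒∣ i∣↧x)))

  primitive-same-↧ₙ⇒↧ₙ≡1 : ∀ x y → Primitive (fin x) (fin y) → ↧ₙ x ≡ ↧ₙ y → ↧ₙ x ≡ 1
  primitive-same-↧ₙ⇒↧ₙ≡1 x y p eq =
    IsUnit-∣⇒≡1 p (∣m∣n⇒∣m-n (∣n⇒∣m*n (↥ x) (∣-reflexive (cong +_ eq))) (∣n⇒∣m*n (↥ y) ∣-refl))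

  det-∞ : ∀ b e → 1ℤ * e - b * 0ℤ ≡ e
  det-∞ = solve-∀

  primitive-∞⇒↧ₙ≡1 : ∀ y → Primitive ∞ (fin y) → ↧ₙ y ≡ 1
  primitive-∞⇒↧ₙ≡1 y p = IsUnit-+⇒≡1 (subst IsUnit (det-∞ (↥ y) (↧ y)) p)

  ↧ₙ≡1⇒primitive-∞ : ∀ y → ↧ₙ y ≡ 1 → Primitive ∞ (fin y)
  ↧ₙ≡1⇒primitive-∞ y eq = inj₁ (trans (det-∞ (↥ y) (↧ y)) (cong +_ eq))

  adjacent-integers : ∀ x y → ↧ₙ x ≡ 1 → ↧ₙ y ≡ 1 → det x y ≡ -1ℤ → ↥ y ≡ ℤ.suc (↥ x)
  adjacent-integers (mkℚ a zero _) (mkℚ b zero _) refl refl det≡-1 = sym (begin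
    1ℤ + a                          ≡⟨ identity a b ⟩
    b + (1ℤ + (a * 1ℤ - b * 1ℤ))    ≡⟨ cong (λ d → b + (1ℤ + d)) det≡-1 ⟩
    b + 0ℤ                          ≡⟨ +-identityʳ b ⟩
    b                               ∎)
    where
    open ≡-Reasoning
    identity : ∀ a b → 1ℤ + a ≡ b + (1ℤ + (a * 1ℤ - b * 1ℤ))
    identity = solve-∀

  floor-lower : ∀ x → floor x * ↧ x ≤ ↥ x
  floor-lower (mkℚ a d _) = [n/d]*d≤n a (+ suc d)

  floor-upper : ∀ x → ↥ x < ℤ.suc (floor x) * ↧ x
  floor-upper (mkℚ a d _) =
    subst (λ q → a < ℤ.suc q * + suc d) (sym (div-pos-is-/ℕ a (suc d))) (n<s[n/ℕd]*d a (suc d))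

  floor-unique : ∀ x q → q * ↧ x ≤ ↥ x → ↥ x < ℤ.suc q * ↧ x → floor x ≡ q
  floor-unique x q lower upper with <-cmp (floor x) q
  ... | tri≈ _ eq _ = eq
  ... | tri< fl<q _ _ = contradiction (floor-upper x)
    (≤⇒≯ (≤-trans (*-monoʳ-≤-nonNeg (↧ x) (i<j⇒suc[i]≤j fl<q)) lower))
  ... | tri> _ _ q<fl = contradiction upper
    (≤⇒≯ (≤-trans (*-monoʳ-≤-nonNeg (↧ x) (i<j⇒suc[i]≤j q<fl)) (floor-lower x)))

  floor-integer : ∀ x → ↧ₙ x ≡ 1 → floor x ≡ ↥ x
  floor-integer x@(mkℚ a zero _) refl = floor-unique x a
    (≤-reflexive (*-identityʳ a))
    (subst (a <_) (sym (*-identityʳ (ℤ.suc a))) (suc[i]≤j⇒i<j ≤-refl))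

  -- With n = ⌊y⌋ and det x y = -1: ↧y (↥x - n ↧x) = -1 + (↥y - n ↧y) ↧x ≥ -1 > -↧y,
  -- and ↧y ((n+1) ↧x - ↥x) = 1 + ((n+1) ↧y - ↥y) ↧x > 0.
  floor-left-neighbour : ∀ {x y} → x ℚ.< y → Primitive (fin x) (fin y) → 2 ℕ.≤ ↧ₙ y
    → floor x ≡ floor y
  floor-left-neighbour {x} {y} x<y p 2≤↧y = floor-unique x n lower upper
    where
    n = floor y
    det≡-1 = <⇒det≡-1 x<y p
    lower-identity : ∀ a b c e n → e * (a - n * c) ≡ (a * e - b * c) + (b - n * e) * c
    lower-identity = solve-∀
    upper-identity : ∀ a b c e n →
      e * ((1ℤ + n) * c - a) ≡ - (a * e - b * c) + ((1ℤ + n) * e - b) * c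
    upper-identity = solve-∀
    lower : n * ↧ x ≤ ↥ x
    lower = 0≤i-j⇒j≤i (-1≤m*i⇒0≤i (↧ₙ y) _ 2≤↧y (begin
      -1ℤ                                ≤⟨ +-monoʳ-≤ -1ℤ
                                              (*-monoʳ-≤-nonNeg (↧ x) (i≤j⇒0≤j-i (floor-lower y))) ⟩
      -1ℤ + (↥ y - n * ↧ y) * ↧ x        ≡⟨ cong (λ d → d + (↥ y - n * ↧ y) * ↧ x) det≡-1 ⟨
      det x y + (↥ y - n * ↧ y) * ↧ x    ≡⟨ lower-identity (↥ x) (↥ y) (↧ x) (↧ y) n ⟨
      ↧ y * (↥ x - n * ↧ x)              ∎))
      where open ≤-Reasoning
    upper : ↥ x < ℤ.suc n * ↧ x
    upper = 0<j-i⇒i<j (*-cancelˡ-<-nonNeg (↧ y) (begin-strict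
      ↧ y * 0ℤ                                   ≡⟨ *-zeroʳ (↧ y) ⟩
      0ℤ                                         <⟨ +-mono-<-≤ (+<+ (s≤s z≤n))
                                                      (*-monoʳ-≤-nonNeg (↧ x)
                                                        (i≤j⇒0≤j-i (<⇒≤ (floor-upper y)))) ⟩
      1ℤ + (ℤ.suc n * ↧ y - ↥ y) * ↧ x
        ≡⟨ cong (λ d → - d + (ℤ.suc n * ↧ y - ↥ y) * ↧ x) det≡-1 ⟨
      - det x y + (ℤ.suc n * ↧ y - ↥ y) * ↧ x    ≡⟨ upper-identity (↥ x) (↥ y) (↧ x) (↧ y) n ⟨
      ↧ y * (ℤ.suc n * ↧ x - ↥ x)                ∎))
      where open ≤-Reasoning

  farey-neighbour : ∀ x y γ → ↧ₙ x ℕ.< ↧ₙ y → ↧ₙ γ ℕ.< ↧ₙ y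
    → Primitive (fin x) (fin y) → det γ y ≡ -1ℤ
    → x ≡ γ ⊎ (det γ x ≡ -1ℤ × det y x ≡ -1ℤ × ↧ₙ γ ℕ.+ ↧ₙ x ≡ ↧ₙ y)
  farey-neighbour x y γ ↧x<↧y ↧γ<↧y (inj₂ det-xy) det-γy =
    inj₁ (det≡0⇒≡ (multiple-of-small-difference≡0 (det x γ) ↧x<↧y ↧γ<↧y (begin
      det x γ * ↧ y                    ≡⟨ det-plücker x y γ ⟩
      det x y * ↧ γ - det γ y * ↧ x    ≡⟨ cong₂ (λ s t → s * ↧ γ - t * ↧ x) det-xy det-γy ⟩
      -1ℤ * ↧ γ - -1ℤ * ↧ x            ≡⟨ simplify (↧ γ) (↧ x) ⟩
      ↧ x - ↧ γ                        ∎)))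
    where
    open ≡-Reasoning
    simplify : ∀ h c → -1ℤ * h - -1ℤ * c ≡ c - h
    simplify = solve-∀
  farey-neighbour x y γ ↧x<↧y ↧γ<↧y (inj₁ det-xy) det-γy =
    inj₂ ( trans (det-antisym x γ) (cong -_ det-xγ≡1)
         , trans (det-antisym x y) (cong -_ det-xy)
         , +-injective (begin
             + (↧ₙ γ ℕ.+ ↧ₙ x)   ≡⟨ det-xγ*↧y ⟨
             det x γ * ↧ y       ≡⟨ cong (_* ↧ y) det-xγ≡1 ⟩
             1ℤ * ↧ y            ≡⟨ *-identityˡ (↧ y) ⟩
             ↧ y                 ∎))
    where
    open ≡-Reasoning
    simplify : ∀ h c → 1ℤ * h - -1ℤ * c ≡ h + c
    simplify = solve-∀
    det-xγ*↧y : det x γ * ↧ y ≡ + (↧ₙ γ ℕ.+ ↧ₙ x)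
    det-xγ*↧y = begin
      det x γ * ↧ y                    ≡⟨ det-plücker x y γ ⟩
      det x y * ↧ γ - det γ y * ↧ x    ≡⟨ cong₂ (λ s t → s * ↧ γ - t * ↧ x) det-xy det-γy ⟩
      1ℤ * ↧ γ - -1ℤ * ↧ x             ≡⟨ simplify (↧ γ) (↧ x) ⟩
      ↧ γ + ↧ x                        ∎
    det-xγ≡1 : det x γ ≡ 1ℤ
    det-xγ≡1 = multiple-of-small-sum≡1 (det x γ) _ (s≤s z≤n) ↧γ<↧y ↧x<↧y det-xγ*↧y

  -- From b u - v e = 1 with u = r + q e, the fraction (v - b q) / r is the neighbour.
  smaller-left-neighbour : ∀ y → 2 ℕ.≤ ↧ₙ y → Σ[ γ ∈ ℚ ] ↧ₙ γ ℕ.< ↧ₙ y × det γ y ≡ -1ℤ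
  smaller-left-neighbour y@(mkℚ b e-1 coprime) 2≤e with bézout b (suc e-1) (recompute coprime)
  ... | u , v , bu-ve≡1 = neighbour (v - b * q) r (n%ℕd<d u e) (begin
    (v - b * q) * + e - b * + r          ≡⟨ expand b v q (+ r) (+ e) ⟩
    - (b * (+ r + q * + e) - v * + e)    ≡⟨ cong (λ t → - (b * t - v * + e)) (a≡a%ℕn+[a/ℕn]*n u e) ⟨
    - (b * u - v * + e)                  ≡⟨ cong -_ bu-ve≡1 ⟩
    -1ℤ                                  ∎)
    where
    open ≡-Reasoning
    e = suc e-1
    q = u /ℕ e
    r = u %ℕ e
    expand : ∀ b v q r e → (v - b * q) * e - b * r ≡ - (b * (r + q * e) - v * e)
    expand = solve-∀
    neighbour : ∀ g c → c ℕ.< e → g * + e - b * + c ≡ -1ℤ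
      → Σ[ γ ∈ ℚ ] ↧ₙ γ ℕ.< e × det γ y ≡ -1ℤ
    neighbour g zero _ eq = contradiction
      (IsUnit-∣⇒≡1 (inj₂ (trans (sym (drop-zero g (+ e) b)) eq)) (∣n⇒∣m*n g ∣-refl))
      (ℕP.<⇒≢ 2≤e ∘ sym)
      where
      drop-zero : ∀ g e b → g * e - b * 0ℤ ≡ g * e
      drop-zero = solve-∀
    neighbour g (suc c-1) c<e eq = mkℚ g c-1 coprime′ , c<e , eq
      where
      coprime′ : Coprime ∣ g ∣ (suc c-1)
      coprime′ (i∣g , i∣c) = IsUnit-∣⇒≡1 (inj₂ eq)
        (∣m∣n⇒∣m-n (∣m⇒∣m*n (+ e) (∣ᵤ⇒∣ {i = g} i∣g)) (∣n⇒∣m*n b (∣ᵤ⇒∣ {i = + suc c-1} i∣c)))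

  parent : (y : ℚ) → 2 ℕ.≤ ↧ₙ y → ℚ
  parent y h = proj₁ (smaller-left-neighbour y h)

  parent-↧ₙ< : ∀ y h → ↧ₙ parent y h ℕ.< ↧ₙ y
  parent-↧ₙ< y h = proj₁ (proj₂ (smaller-left-neighbour y h))

  parent-det : ∀ y h → det (parent y h) y ≡ -1ℤ
  parent-det y h = proj₂ (proj₂ (smaller-left-neighbour y h))

  parent-↧ₙ≤ : ∀ y h {k} → ↧ₙ y ℕ.≤ suc k → ↧ₙ parent y h ℕ.≤ k
  parent-↧ₙ≤ y h ↧y≤ = ℕP.m<1+n⇒m≤n (ℕP.<-≤-trans (parent-↧ₙ< y h) ↧y≤)

  ↧ₙ<⇒2≤↧ₙ : ∀ x y → ↧ₙ x ℕ.< ↧ₙ y → 2 ℕ.≤ ↧ₙ y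
  ↧ₙ<⇒2≤↧ₙ _ _ = ℕP.≤-trans (s≤s (s≤s z≤n))

  2≰↧ₙ⇒↧ₙ≡1 : ∀ x → ¬ 2 ℕ.≤ ↧ₙ x → ↧ₙ x ≡ 1
  2≰↧ₙ⇒↧ₙ≡1 x 2≰ = ℕP.≤-antisym (ℕP.≤-pred (ℕP.≰⇒> 2≰)) (s≤s z≤n)

  parent-induction : ∀ {p} (P : ℚ → Set p) → (∀ x → ↧ₙ x ≡ 1 → P x)
    → (∀ x h → P (parent x h) → P x) → ∀ x → P x
  parent-induction P base step x = go (↧ₙ x) x ℕP.≤-refl
    where
    go : ∀ k x → ↧ₙ x ℕ.≤ k → P x
    go (suc k) x ↧x≤ with 2 ℕ.≤? ↧ₙ x
    ... | yes h  = step x h (go k (parent x h) (parent-↧ₙ≤ x h ↧x≤))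
    ... | no 2≰ = base x (2≰↧ₙ⇒↧ₙ≡1 x 2≰)

  ≡-by-common-factor : ∀ p q k → ↥ p * k ≡ ↥ q → ↧ p * k ≡ ↧ q → p ≡ q
  ≡-by-common-factor p q k ↥p*k≡↥q ↧p*k≡↧q = ℚP.≃⇒≡ (ℚ.*≡* (begin
    ↥ p * ↧ q           ≡⟨ cong (↥ p *_) ↧p*k≡↧q ⟨
    ↥ p * (↧ p * k)     ≡⟨ rearrange (↥ p) (↧ p) k ⟩
    ↥ p * k * ↧ p       ≡⟨ cong (_* ↧ p) ↥p*k≡↥q ⟩
    ↥ q * ↧ p           ∎))
    where
    open ≡-Reasoning
    rearrange : ∀ a d k → a * (d * k) ≡ a * k * d
    rearrange = solve-∀

  intℚ≡mkℚ : ∀ n → intℚ n ≡ mkℚ n 0 (λ (_ , i∣1) → ℕD.∣1⇒≡1 i∣1)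
  intℚ≡mkℚ n = ≡-by-common-factor (intℚ n) _ (gcd n 1ℤ) (ℚP.↥-/ n 1) (ℚP.↧-/ n 1)

  shift-coprime : ∀ n x → Coprime ∣ n * ↧ x + ↥ x ∣ (↧ₙ x)
  shift-coprime n x@(mkℚ a d coprime) {i} (i∣num , i∣den) = recompute coprime
    (∣⇒∣ᵤ (∣m+n∣m⇒∣n (∣ᵤ⇒∣ {+ i} {n * ↧ x + a} i∣num) (∣n⇒∣m*n n (∣ᵤ⇒∣ {+ i} {↧ x} i∣den))) , i∣den)

  shift : ℤ → ℚ → ℚ
  shift n x = mkℚ (n * ↧ x + ↥ x) (ℚ.denominator-1 x) (shift-coprime n x)

  intℚ+≡shift : ∀ n x → intℚ n ℚ.+ x ≡ shift n x
  intℚ+≡shift n x = trans (cong (ℚ._+ x) (intℚ≡mkℚ n)) (≡-by-common-factor (n/1 ℚ.+ x) (shift n x) _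
    (trans (ℚP.↥-+ n/1 x) (cong (λ t → n * ↧ x + t) (*-identityʳ (↥ x))))
    (trans (ℚP.↧-+ n/1 x) (*-identityˡ (↧ x))))
    where n/1 = mkℚ n 0 (λ (_ , i∣1) → ℕD.∣1⇒≡1 i∣1)

  det-shift : ∀ n x y → det (shift n x) (shift n y) ≡ det x y
  det-shift n x y = identity n (↥ x) (↧ x) (↥ y) (↧ y)
    where
    identity : ∀ n a c b e → (n * c + a) * e - (n * e + b) * c ≡ a * e - b * c
    identity = solve-∀

  floor-shift : ∀ n x → 0ℚ ℚ.≤ x → x ℚ.< 1ℚ → floor (shift n x) ≡ n
  floor-shift n x 0≤x x<1 = floor-unique (shift n x) n
    (subst (_≤ n * ↧ x + ↥ x) (+-identityʳ (n * ↧ x)) (+-monoʳ-≤ (n * ↧ x) 0≤↥x))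
    (subst (n * ↧ x + ↥ x <_) (trans (+-comm (n * ↧ x) (↧ x)) (sym (suc-* n (↧ x))))
      (+-monoʳ-< (n * ↧ x) ↥x<↧x))
    where
    0≤↥x : 0ℤ ≤ ↥ x
    0≤↥x = subst (0ℤ ≤_) (*-identityʳ (↥ x)) (ℚP.drop-*≤* 0≤x)
    ↥x<↧x : ↥ x < ↧ x
    ↥x<↧x = subst₂ _<_ (*-identityʳ (↥ x)) (*-identityˡ (↧ x)) (ℚP.drop-*<* x<1)

module PseudoMeasures {c ℓ : Level} (W : AbelianGroup c ℓ) where

  open AbelianGroup W
  open import Algebra.Properties.AbelianGroup W using (⁻¹-anti-homo‿-)
  open import Algebra.Properties.Group group
    using (inverseˡ-unique; \\-leftDividesʳ; //-cong₂; quasigroup)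
  open import Algebra.Properties.Quasigroup quasigroup using (x≈z//y)
  open import Data.Product using (proj₁; proj₂)
  open import Relation.Binary.Reasoning.Setoid setoid
  open Farey using (parent; parent-det; parent-induction; ↧ₙ≡1⇒primitive-∞)

  y≈z-x : ∀ x y z → x ∙ y ≈ z → y ≈ z - x
  y≈z-x x y z eq = x≈z//y y x z (trans (comm y x) eq)

  coboundary : ∀ {a} {A : Set a} → (A → Carrier) → A → A → Carrier
  coboundary g α β = g β - g α

  coboundary-∙ : ∀ {a} {A : Set a} (g : A → Carrier) α β γ →
    coboundary g α β ∙ coboundary g β γ ≈ coboundary g α γ
  coboundary-∙ g α β γ = begin
    (g β - g α) ∙ (g γ - g β)          ≈⟨ comm _ _ ⟩
    (g γ ∙ g β ⁻¹) ∙ (g β ∙ g α ⁻¹)    ≈⟨ assoc _ _ _ ⟩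
    g γ ∙ (g β ⁻¹ ∙ (g β ∙ g α ⁻¹))    ≈⟨ ∙-congˡ (\\-leftDividesʳ (g β) (g α ⁻¹)) ⟩
    g γ - g α                          ∎

  coboundary-isPseudoMeasure : ∀ g → IsPseudoMeasure W (coboundary g)
  coboundary-isPseudoMeasure g = (λ α → inverseʳ (g α)) , antisym , cocycle
    where
    antisym : ∀ α β → coboundary g α β ∙ coboundary g β α ≈ ε
    antisym α β = trans (∙-congˡ (sym (⁻¹-anti-homo‿- (g β) (g α)))) (inverseʳ _)
    cocycle : ∀ α β γ → (coboundary g α β ∙ coboundary g β γ) ∙ coboundary g γ α ≈ ε
    cocycle α β γ = trans (∙-congʳ (coboundary-∙ g α β γ)) (antisym α γ)

  module _ {μ : P1 → P1 → Carrier} (isPseudoMeasure : IsPseudoMeasure W μ) where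

    pseudoMeasure-∙ : ∀ α β γ → μ α β ∙ μ β γ ≈ μ α γ
    pseudoMeasure-∙ α β γ = trans (inverseˡ-unique _ _ (proj₂ (proj₂ isPseudoMeasure) α β γ))
      (sym (inverseˡ-unique _ _ (proj₁ (proj₂ isPseudoMeasure) α γ)))

    pseudoMeasure≈coboundary : ∀ α β → μ α β ≈ coboundary (μ ∞) α β
    pseudoMeasure≈coboundary α β = y≈z-x (μ ∞ α) (μ α β) (μ ∞ β) (pseudoMeasure-∙ ∞ α β)

  ≈-on-primitive⇒≈ : ∀ {μ₁ μ₂} → IsPseudoMeasure W μ₁ → IsPseudoMeasure W μ₂
    → (∀ α β → Primitive α β → μ₁ α β ≈ μ₂ α β) → ∀ α β → μ₁ α β ≈ μ₂ α β
  ≈-on-primitive⇒≈ {μ₁} {μ₂} pm₁ pm₂ agree α β = begin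
    μ₁ α β              ≈⟨ pseudoMeasure≈coboundary pm₁ α β ⟩
    μ₁ ∞ β - μ₁ ∞ α     ≈⟨ //-cong₂ (from-∞ β) (from-∞ α) ⟩
    μ₂ ∞ β - μ₂ ∞ α     ≈⟨ pseudoMeasure≈coboundary pm₂ α β ⟨
    μ₂ α β              ∎
    where
    step : ∀ x h → μ₁ ∞ (fin (parent x h)) ≈ μ₂ ∞ (fin (parent x h))
      → μ₁ ∞ (fin x) ≈ μ₂ ∞ (fin x)
    step x h μ₁≈μ₂ = begin
      μ₁ ∞ (fin x)                        ≈⟨ pseudoMeasure-∙ pm₁ ∞ (fin γ) (fin x) ⟨
      μ₁ ∞ (fin γ) ∙ μ₁ (fin γ) (fin x)
        ≈⟨ ∙-cong μ₁≈μ₂ (agree (fin γ) (fin x) (inj₂ (parent-det x h))) ⟩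
      μ₂ ∞ (fin γ) ∙ μ₂ (fin γ) (fin x)   ≈⟨ pseudoMeasure-∙ pm₂ ∞ (fin γ) (fin x) ⟩
      μ₂ ∞ (fin x)                        ∎
      where γ = parent x h
    from-∞ : ∀ α → μ₁ ∞ α ≈ μ₂ ∞ α
    from-∞ ∞       = trans (proj₁ pm₁ ∞) (sym (proj₁ pm₂ ∞))
    from-∞ (fin x) = parent-induction (λ x → μ₁ ∞ (fin x) ≈ μ₂ ∞ (fin x))
      (λ x ↧x≡1 → agree ∞ (fin x) (↧ₙ≡1⇒primitive-∞ x ↧x≡1)) step x

module Extension {c ℓ : Level} (W : AbelianGroup c ℓ) (ω : AbelianGroup.Carrier W)
  (R : ℤ → ℕ → ℕ → AbelianGroup.Carrier W) (R-reciprocity : ∀ n → IsReciprocity W (R n))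
  where

  open AbelianGroup W
  open Construction W ω R
  open PseudoMeasures W
  open Farey
  open import Algebra.Properties.AbelianGroup W using (⁻¹-∙-comm)
  open import Algebra.Properties.Group group using (inverseʳ-unique; ε⁻¹≈ε; quasigroup)
  open import Algebra.Properties.Quasigroup quasigroup using (y≈x\\z)
  open import Data.Nat using (zero; suc; z≤n; s≤s)
  import Data.Nat.Properties as ℕP
  open import Data.Integer using (+_; -[1+_]; -1ℤ)
  open import Data.Rational using (mkℚ; ↥_; floor)
  import Data.Rational.Properties as ℚP
  open import Data.Product using (proj₁; proj₂)
  open import Relation.Binary.Definitions using (tri<; tri≈; tri>)
  open ≡ using (cong; cong₂)
  open import Relation.Nullary using (contradiction; yes; no)
  open import Relation.Binary.Reasoning.Setoid setoid

  μ̃-< : ∀ {x y} → x ℚ.< y → μ̃ (fin x) (fin y) ≡ R (floor x) (↧ₙ x) (↧ₙ y)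
  μ̃-< {x} {y} x<y with x ℚP.<? y | y ℚP.<? x
  ... | yes _  | _ = ≡.refl
  ... | no x≮y | _ = contradiction x<y x≮y

  μ̃-> : ∀ {x y} → y ℚ.< x → μ̃ (fin x) (fin y) ≡ R (floor y) (↧ₙ y) (↧ₙ x) ⁻¹
  μ̃-> {x} {y} y<x with x ℚP.<? y | y ℚP.<? x
  ... | yes x<y | _      = contradiction x<y (ℚP.<-asym y<x)
  ... | no _    | yes _  = ≡.refl
  ... | no _    | no y≮x = contradiction y<x y≮x

  μ̃-refl : ∀ x → μ̃ (fin x) (fin x) ≡ ε
  μ̃-refl x with x ℚP.<? x
  ... | yes x<x = contradiction x<x (ℚP.<-irrefl ≡.refl)
  ... | no _    = ≡.refl

  μ̃-antisym : ∀ α β → μ̃ α β ∙ μ̃ β α ≈ ε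
  μ̃-antisym ∞       ∞       = identityʳ ε
  μ̃-antisym ∞       (fin y) = inverseʳ _
  μ̃-antisym (fin x) ∞       = inverseˡ _
  μ̃-antisym (fin x) (fin y) with ℚP.<-cmp x y
  ... | tri< x<y _ _    = trans (∙-cong (reflexive (μ̃-< x<y)) (reflexive (μ̃-> x<y))) (inverseʳ _)
  ... | tri≈ _ ≡.refl _ = trans (∙-cong (reflexive (μ̃-refl x)) (reflexive (μ̃-refl x))) (identityʳ ε)
  ... | tri> _ _ y<x    = trans (∙-cong (reflexive (μ̃-> y<x)) (reflexive (μ̃-< y<x))) (inverseˡ _)

  x∙[y∙z]⁻¹∙z≈x∙y⁻¹ : ∀ x y z → (x ∙ (y ∙ z) ⁻¹) ∙ z ≈ x ∙ y ⁻¹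
  x∙[y∙z]⁻¹∙z≈x∙y⁻¹ x y z = begin
    (x ∙ (y ∙ z) ⁻¹) ∙ z        ≈⟨ ∙-congʳ (∙-congˡ (⁻¹-∙-comm y z)) ⟨
    (x ∙ (y ⁻¹ ∙ z ⁻¹)) ∙ z     ≈⟨ assoc _ _ _ ⟩
    x ∙ ((y ⁻¹ ∙ z ⁻¹) ∙ z)     ≈⟨ ∙-congˡ (assoc _ _ _) ⟩
    x ∙ (y ⁻¹ ∙ (z ⁻¹ ∙ z))     ≈⟨ ∙-congˡ (∙-congˡ (inverseˡ z)) ⟩
    x ∙ (y ⁻¹ ∙ ε)              ≈⟨ ∙-congˡ (identityʳ _) ⟩
    x ∙ y ⁻¹                    ∎

  μ∞-suc : ∀ n → μ∞ (ℤ.suc n) ≈ μ∞ n ∙ R n 1 1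
  μ∞-suc (+ n)        = sym (assoc ω (sumUp n) (R (+ n) 1 1))
  μ∞-suc -[1+ zero ]  = trans (∙-congˡ (sym ε⁻¹≈ε)) (sym (x∙[y∙z]⁻¹∙z≈x∙y⁻¹ ω ε _))
  μ∞-suc -[1+ suc m ] = sym (x∙[y∙z]⁻¹∙z≈x∙y⁻¹ ω (sumDown (suc m)) _)

  μ̃-mediant : ∀ a m b → det a m ≡ -1ℤ → det m b ≡ -1ℤ → det a b ≡ -1ℤ
    → ↧ₙ a ℕ.+ ↧ₙ b ≡ ↧ₙ m → μ̃ (fin a) (fin m) ∙ μ̃ (fin m) (fin b) ≈ μ̃ (fin a) (fin b)
  μ̃-mediant a m b det-am det-mb det-ab ↧a+↧b≡↧m = begin
    μ̃ (fin a) (fin m) ∙ μ̃ (fin m) (fin b)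
      ≡⟨ cong₂ _∙_ (μ̃-< (det≡-1⇒< a m det-am)) (μ̃-< (det≡-1⇒< m b det-mb)) ⟩
    R n (↧ₙ a) (↧ₙ m) ∙ R (floor m) (↧ₙ m) (↧ₙ b)
      ≡⟨ cong (λ k → R n (↧ₙ a) (↧ₙ m) ∙ R k (↧ₙ m) (↧ₙ b)) floor-m≡n ⟩
    R n (↧ₙ a) (↧ₙ m) ∙ R n (↧ₙ m) (↧ₙ b)   ≈⟨ comm _ _ ⟩
    R n (↧ₙ m) (↧ₙ b) ∙ R n (↧ₙ a) (↧ₙ m)   ≈⟨ reciprocity ⟩
    R n (↧ₙ a) (↧ₙ b)                       ≡⟨ μ̃-< (det≡-1⇒< a b det-ab) ⟨
    μ̃ (fin a) (fin b)                       ∎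
    where
    n = floor a
    2≤↧m : 2 ℕ.≤ ↧ₙ m
    2≤↧m = ≡.subst (2 ℕ.≤_) ↧a+↧b≡↧m (ℕP.+-mono-≤ (s≤s z≤n) (s≤s z≤n))
    floor-m≡n : floor m ≡ n
    floor-m≡n = ≡.sym (floor-left-neighbour (det≡-1⇒< a m det-am) (inj₂ det-am) 2≤↧m)
    reciprocity : R n (↧ₙ m) (↧ₙ b) ∙ R n (↧ₙ a) (↧ₙ m) ≈ R n (↧ₙ a) (↧ₙ b)
    reciprocity = ≡.subst (λ k → R n k (↧ₙ b) ∙ R n (↧ₙ a) k ≈ R n (↧ₙ a) (↧ₙ b)) ↧a+↧b≡↧m
      (R-reciprocity n (↧ₙ a) (↧ₙ b) (s≤s z≤n , s≤s z≤n , primitive⇒coprime-↧ₙ a b (inj₂ det-ab)))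

  -- Fuel k ≥ ↧ₙ x suffices, as parents have smaller denominators; the value
  -- ε at fuel 0 is never reached.
  potentialWithin : ℕ → ℚ → Carrier
  potentialWithin zero    _ = ε
  potentialWithin (suc k) x with 2 ℕ.≤? ↧ₙ x
  ... | yes h = potentialWithin k (parent x h) ∙ μ̃ (fin (parent x h)) (fin x)
  ... | no  _ = μ∞ (↥ x)

  potential : P1 → Carrier
  potential ∞       = ε
  potential (fin x) = potentialWithin (↧ₙ x) x

  potentialWithin-stable : ∀ k k′ x → ↧ₙ x ℕ.≤ k → ↧ₙ x ℕ.≤ k′
    → potentialWithin k x ≡ potentialWithin k′ x
  potentialWithin-stable (suc k) (suc k′) x ↧x≤k ↧x≤k′ with 2 ℕ.≤? ↧ₙ x
  ... | yes h = cong (_∙ μ̃ (fin (parent x h)) (fin x))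
    (potentialWithin-stable k k′ (parent x h) (parent-↧ₙ≤ x h ↧x≤k) (parent-↧ₙ≤ x h ↧x≤k′))
  ... | no _ = ≡.refl

  potential-parent : ∀ x h
    → potential (fin x) ≡ potential (fin (parent x h)) ∙ μ̃ (fin (parent x h)) (fin x)
  potential-parent x h with 2 ℕ.≤? ↧ₙ x
  ... | yes h′ rewrite ℕP.≤-irrelevant h′ h = cong (_∙ μ̃ (fin (parent x h)) (fin x))
    (potentialWithin-stable _ _ (parent x h) (parent-↧ₙ≤ x h ℕP.≤-refl) ℕP.≤-refl)
  ... | no 2≰ = contradiction h 2≰

  potential-integer : ∀ x → ↧ₙ x ≡ 1 → potential (fin x) ≡ μ∞ (↥ x)
  potential-integer (mkℚ _ zero _) ≡.refl = ≡.refl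

  μ : P1 → P1 → Carrier
  μ = coboundary potential

  μ-isPseudoMeasure : IsPseudoMeasure W μ
  μ-isPseudoMeasure = coboundary-isPseudoMeasure potential

  μ≈μ̃-flip : ∀ α β → μ α β ≈ μ̃ α β → μ β α ≈ μ̃ β α
  μ≈μ̃-flip α β μ≈μ̃ = begin
    μ β α       ≈⟨ inverseʳ-unique _ _ (proj₁ (proj₂ μ-isPseudoMeasure) α β) ⟩
    μ α β ⁻¹    ≈⟨ ⁻¹-cong μ≈μ̃ ⟩
    μ̃ α β ⁻¹    ≈⟨ inverseʳ-unique _ _ (μ̃-antisym α β) ⟨
    μ̃ β α       ∎

  μ≈μ̃-parent : ∀ x h → μ (fin (parent x h)) (fin x) ≈ μ̃ (fin (parent x h)) (fin x)
  μ≈μ̃-parent x h = sym (y≈z-x _ _ _ (sym (reflexive (potential-parent x h))))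

  μ≈μ̃-∞ : ∀ x → ↧ₙ x ≡ 1 → μ ∞ (fin x) ≈ μ̃ ∞ (fin x)
  μ≈μ̃-∞ x ↧x≡1 =
    sym (y≈z-x _ _ _ (trans (identityˡ _) (sym (reflexive (potential-integer x ↧x≡1)))))

  μ≈μ̃-suc : ∀ x y → ↧ₙ x ≡ 1 → ↧ₙ y ≡ 1 → det x y ≡ -1ℤ
    → μ (fin x) (fin y) ≈ μ̃ (fin x) (fin y)
  μ≈μ̃-suc x y ↧x≡1 ↧y≡1 det≡-1 = begin
    μ (fin x) (fin y)              ≡⟨ cong₂ _-_ (potential-integer y ↧y≡1) (potential-integer x ↧x≡1) ⟩
    μ∞ (↥ y) - μ∞ (↥ x)
      ≡⟨ cong (λ k → μ∞ k - μ∞ (↥ x)) (adjacent-integers x y ↧x≡1 ↧y≡1 det≡-1) ⟩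
    μ∞ (ℤ.suc (↥ x)) - μ∞ (↥ x)    ≈⟨ y≈z-x _ _ _ (sym (μ∞-suc (↥ x))) ⟨
    R (↥ x) 1 1                    ≡⟨ cong (λ k → R k 1 1) (floor-integer x ↧x≡1) ⟨
    R (floor x) 1 1                ≡⟨ cong₂ (R (floor x)) ↧x≡1 ↧y≡1 ⟨
    R (floor x) (↧ₙ x) (↧ₙ y)      ≡⟨ μ̃-< (det≡-1⇒< x y det≡-1) ⟨
    μ̃ (fin x) (fin y)              ∎

  μ≈μ̃-integers : ∀ x y → ↧ₙ x ≡ 1 → ↧ₙ y ≡ 1 → Primitive (fin x) (fin y)
    → μ (fin x) (fin y) ≈ μ̃ (fin x) (fin y)
  μ≈μ̃-integers x y ↧x≡1 ↧y≡1 (inj₂ det≡-1) = μ≈μ̃-suc x y ↧x≡1 ↧y≡1 det≡-1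
  μ≈μ̃-integers x y ↧x≡1 ↧y≡1 (inj₁ det≡1)  = μ≈μ̃-flip (fin y) (fin x)
    (μ≈μ̃-suc y x ↧y≡1 ↧x≡1 (≡.trans (det-antisym x y) (cong ℤ.-_ det≡1)))

  μ≈μ̃-below : ∀ x y (h : 2 ℕ.≤ ↧ₙ y) → ↧ₙ x ℕ.< ↧ₙ y → Primitive (fin x) (fin y)
    → (Primitive (fin (parent y h)) (fin x)
         → μ (fin (parent y h)) (fin x) ≈ μ̃ (fin (parent y h)) (fin x))
    → μ (fin x) (fin y) ≈ μ̃ (fin x) (fin y)
  μ≈μ̃-below x y h ↧x<↧y p μ≈μ̃-γx
    with farey-neighbour x y (parent y h) ↧x<↧y (parent-↧ₙ< y h) p (parent-det y h)
  ... | inj₁ ≡.refl = μ≈μ̃-parent y h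
  ... | inj₂ (det-γx , det-yx , ↧γ+↧x≡↧y) = μ≈μ̃-flip (fin y) (fin x) (begin
    μ (fin y) (fin x)
      ≈⟨ y≈x\\z _ _ _ (coboundary-∙ potential (fin γ) (fin y) (fin x)) ⟩
    μ (fin γ) (fin y) ⁻¹ ∙ μ (fin γ) (fin x)
      ≈⟨ ∙-cong (⁻¹-cong (μ≈μ̃-parent y h)) (μ≈μ̃-γx (inj₂ det-γx)) ⟩
    μ̃ (fin γ) (fin y) ⁻¹ ∙ μ̃ (fin γ) (fin x)
      ≈⟨ y≈x\\z _ _ _ (μ̃-mediant γ y x (parent-det y h) det-yx det-γx ↧γ+↧x≡↧y) ⟨
    μ̃ (fin y) (fin x)
      ∎)
    where γ = parent y h

  μ≈μ̃-fin : ∀ k x y → ↧ₙ x ℕ.≤ k → ↧ₙ y ℕ.≤ k → Primitive (fin x) (fin y)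
    → μ (fin x) (fin y) ≈ μ̃ (fin x) (fin y)
  μ≈μ̃-fin (suc k) x y ↧x≤ ↧y≤ p with ℕP.<-cmp (↧ₙ x) (↧ₙ y)
  ... | tri< ↧x<↧y _ _ = μ≈μ̃-below x y h ↧x<↧y p (μ≈μ̃-fin k (parent y h) x
      (parent-↧ₙ≤ y h ↧y≤) (ℕP.m<1+n⇒m≤n (ℕP.<-≤-trans ↧x<↧y ↧y≤)))
    where h = ↧ₙ<⇒2≤↧ₙ x y ↧x<↧y
  ... | tri≈ _ ↧x≡↧y _ = μ≈μ̃-integers x y ↧x≡1 (≡.trans (≡.sym ↧x≡↧y) ↧x≡1) p
    where ↧x≡1 = primitive-same-↧ₙ⇒↧ₙ≡1 x y p ↧x≡↧y
  ... | tri> _ _ ↧y<↧x = μ≈μ̃-flip (fin y) (fin x) (μ≈μ̃-below y x h ↧y<↧x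
      (Primitive-sym (fin x) (fin y) p) (μ≈μ̃-fin k (parent x h) y
        (parent-↧ₙ≤ x h ↧x≤) (ℕP.m<1+n⇒m≤n (ℕP.<-≤-trans ↧y<↧x ↧x≤))))
    where h = ↧ₙ<⇒2≤↧ₙ y x ↧y<↧x

  μ≈μ̃ : ∀ α β → Primitive α β → μ α β ≈ μ̃ α β
  μ≈μ̃ ∞       ∞       (inj₁ ())
  μ≈μ̃ ∞       ∞       (inj₂ ())
  μ≈μ̃ ∞       (fin y) p = μ≈μ̃-∞ y (primitive-∞⇒↧ₙ≡1 y p)
  μ≈μ̃ (fin x) ∞       p =
    μ≈μ̃-flip ∞ (fin x) (μ≈μ̃-∞ x (primitive-∞⇒↧ₙ≡1 x (Primitive-sym (fin x) ∞ p)))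
  μ≈μ̃ (fin x) (fin y) p = μ≈μ̃-fin _ x y (ℕP.m≤m⊔n (↧ₙ x) (↧ₙ y)) (ℕP.m≤n⊔m (↧ₙ x) (↧ₙ y)) p

  μ̃-cocycle : ∀ α β γ → Primitive α β → Primitive β γ → Primitive γ α
    → (μ̃ α β ∙ μ̃ β γ) ∙ μ̃ γ α ≈ ε
  μ̃-cocycle α β γ p q r = trans
    (∙-cong (∙-cong (sym (μ≈μ̃ α β p)) (sym (μ≈μ̃ β γ q))) (sym (μ≈μ̃ γ α r)))
    (proj₂ (proj₂ μ-isPseudoMeasure) α β γ)

  μ-shift : ∀ n x y → 0ℚ ℚ.≤ x → x ℚ.< y → y ℚ.≤ 1ℚ → Primitive (fin x) (fin y)
    → R n (↧ₙ x) (↧ₙ y) ≈ μ (fin (intℚ n ℚ.+ x)) (fin (intℚ n ℚ.+ y))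
  μ-shift n x y 0≤x x<y y≤1 p rewrite intℚ+≡shift n x | intℚ+≡shift n y = sym (begin
    μ (fin X) (fin Y)           ≈⟨ μ≈μ̃ (fin X) (fin Y) (inj₂ det-XY) ⟩
    μ̃ (fin X) (fin Y)           ≡⟨ μ̃-< (det≡-1⇒< X Y det-XY) ⟩
    R (floor X) (↧ₙ x) (↧ₙ y)
      ≡⟨ cong (λ k → R k (↧ₙ x) (↧ₙ y)) (floor-shift n x 0≤x (ℚP.<-≤-trans x<y y≤1)) ⟩
    R n (↧ₙ x) (↧ₙ y)           ∎)
    where
    X = shift n x
    Y = shift n y
    det-XY : det X Y ≡ -1ℤ
    det-XY = ≡.trans (det-shift n x y) (<⇒det≡-1 x<y p)

theorem1p11 : {c ℓ : Level} (W : AbelianGroup c ℓ)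
  → (ω : AbelianGroup.Carrier W)
  → (R : ℤ → ℕ → ℕ → AbelianGroup.Carrier W)
  → (∀ n → IsReciprocity W (R n))
  → let open AbelianGroup W
        open Construction W ω R
    in
    (∀ α β → Primitive α β → (μ̃ α β ∙ μ̃ β α) ≈ ε)
    × (∀ α β γ → Primitive α β → Primitive β γ → Primitive γ α
         → ((μ̃ α β ∙ μ̃ β γ) ∙ μ̃ γ α) ≈ ε)
    × (Σ (P1 → P1 → Carrier) λ μ →
         IsPseudoMeasure W μ
         × (∀ α β → Primitive α β → μ α β ≈ μ̃ α β)
         × (∀ μ′ → IsPseudoMeasure W μ′
              → (∀ α β → Primitive α β → μ′ α β ≈ μ̃ α β)
              → ∀ α β → μ′ α β ≈ μ α β)
         × (ω ≈ μ ∞ (fin 0ℚ))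
         × (∀ (n : ℤ) (p q : ℕ) → InV0 W p q → (x y : ℚ)
              → 0ℚ ℚ.≤ x → x ℚ.< y → y ℚ.≤ 1ℚ
              → Primitive (fin x) (fin y)
              → ↧ₙ x ≡ p → ↧ₙ y ≡ q
              → R n p q ≈ μ (fin (intℚ n ℚ.+ x)) (fin (intℚ n ℚ.+ y))))
theorem1p11 W ω R R-reciprocity =
    (λ α β _ → μ̃-antisym α β)
  , μ̃-cocycle
  , μ
  , μ-isPseudoMeasure
  , μ≈μ̃
  , (λ μ′ μ′-isPseudoMeasure μ′≈μ̃ → ≈-on-primitive⇒≈ μ′-isPseudoMeasure μ-isPseudoMeasure
      (λ α β p → trans (μ′≈μ̃ α β p) (sym (μ≈μ̃ α β p))))
  , sym (trans (μ≈μ̃ ∞ (fin 0ℚ) (inj₁ ≡.refl)) (identityʳ ω))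
  , λ { n _ _ _ x y 0≤x x<y y≤1 x,y-primitive ≡.refl ≡.refl →
          μ-shift n x y 0≤x x<y y≤1 x,y-primitive }
  where
  open AbelianGroup W
  open PseudoMeasures W
  open Extension W ω R R-reciprocity
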